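{- Let $G$ be a connected finite simple graph with at least one edge, and let $Q = Q(G[:])$ be any spinal quadrangulation with spine $G$. Then $$\chi_V(G[:]) = \chi_V(G) \ge \chi_F(Q).$$
   Context: The $2$-fold interlacement $G[:]$ of $G$ has vertex set $\{v', v'' : v \in V(G)\}$; $v'$ and $v''$ are non-adjacent, and for each edge $vu$ of $G$ there are exactly the four edges $v'u', v'u'', v''u', v''u''$. Spinal construction: realize $G$ in $E^3$. For each vertex $v$ take a sphere $S_v$ (disjoint spheres), mark two antipodal points on it representing $v'$ and $v''$, and cut out $\deg v$ disjoint quadrilateral holes; for each edge $vu$ choose a hole $h_{vu}$ in $S_v$ and a hole $h_{uv}$ in $S_u$, each hole used for exactly one edge. For each hole in $S_v$, draw disjoint arcs on $S_v$ joining $v'$ to two consecutive corners of the hole and $v''$ to the other two corners. For each edge $vu$, glue a tube with square cross-section (four long edges being arcs) onto the boundaries of $h_{vu}$ and $h_{uv}$, keeping the surface orientable, with a quarter-twist (either direction) so that the four long edges complete the arcs into exactly the edges $v'u', v'u'', v''u', v''u''$. The result is an embedding of $G[:]$ on a closed orientable surface $\Sigma_g$ in which every face is bounded by a simple $4$-cycle and every edge lies on exactly two faces; any embedding obtained this way is a spinal quadrangulation with spine $G$. $\chi_V(H)$ is the vertex chromatic number of a graph $H$ (minimum number of colors in a proper vertex coloring). $\chi_F(Q)$ is the face chromatic number of $Q$: the minimum number of colors in a coloring of the quadrilateral faces of $Q$ such that any two faces meeting a common edge receive different colors. -}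

module Defs where

open import Data.Nat using (ℕ; _≤_)
open import Data.Nat using () renaming (suc to sucℕ)
open import Data.Nat.DivMod using (_%_; m%n<n)
open import Data.Fin using (Fin; toℕ; fromℕ<; zero; suc)
open import Data.Bool using (Bool; true; false; not)
open import Data.Product using (Σ; ∃; ∃-syntax; _×_; _,_; proj₁)
open import Data.Sum using (_⊎_)
open import Data.List using (List; length; lookup)
open import Data.List.Membership.Propositional using (_∈_)
open import Data.List.Relation.Unary.Unique.Propositional using (Unique)
open import Relation.Binary.PropositionalEquality using (_≡_; _≢_)
open import Relation.Binary.Construct.Closure.ReflexiveTransitive using (Star)
open import Relation.Nullary using (¬_)

record Graph (V : Set) : Set₁ where
  field
    Adj    : V → V → Set
    sym    : ∀ {u v} → Adj u v → Adj v u
    irrefl : ∀ {v} → ¬ Adj v v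

open Graph public

Connected : ∀ {V} → Graph V → Set
Connected G = ∀ u v → Star (Adj G) u v

HasEdge : ∀ {V} → Graph V → Set
HasEdge {V} G = Σ V λ u → Σ V λ v → Adj G u v

Colorable : ∀ {V} → Graph V → ℕ → Set
Colorable {V} G k = Σ (V → Fin k) λ c → ∀ {u v} → Adj G u v → c u ≢ c v

IsChromaticNumber : ∀ {V} → Graph V → ℕ → Set
IsChromaticNumber G k = Colorable G k × (∀ j → Colorable G j → k ≤ j)

-- 2-fold interlacement G[:]  ;  (v , false) = v' ,  (v , true) = v''

interlace : ∀ {V} → Graph V → Graph (V × Bool)
interlace G = record
  { Adj    = λ x y → Adj G (proj₁ x) (proj₁ y)
  ; sym    = sym G
  ; irrefl = irrefl G
  }

cnext : ∀ {m} → Fin m → Fin m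
cnext {sucℕ m} i = fromℕ< (m%n<n (sucℕ (toℕ i)) (sucℕ m))

-- Spinal quadrangulations (combinatorial description of the spinal
-- construction):
--  * rot v   : the cyclic order (rotation) of the holes h_{vu} on S_v,
--              listing each neighbour u of v exactly once;
--  * twist v u (= twist u v): quarter-twist direction of the tube of
--              edge vu; it says which copy of u lies on the flank of
--              h_{vu} facing the next hole in the rotation at v
--              (the other copy lies on the flank facing the previous one).

record Spinal {n : ℕ} (G : Graph (Fin n)) : Set where
  field
    rot        : Fin n → List (Fin n)
    rot-unique : ∀ v → Unique (rot v)
    rot-adj    : ∀ v u → u ∈ rot v → Adj G v u
    adj-rot    : ∀ v u → Adj G v u → u ∈ rot v
    twist      : Fin n → Fin n → Bool
    twist-sym  : ∀ u v → twist u v ≡ twist v u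

open Spinal public

-- faces: one for each pair of consecutive holes around each vertex v
Face : ∀ {n} {G : Graph (Fin n)} → Spinal G → Set
Face {n} Q = Σ (Fin n) λ v → Fin (length (rot Q v))

corner : ∀ {n} {G : Graph (Fin n)} (Q : Spinal G) → Face Q → Fin 4 → Fin n × Bool
corner Q (v , i) zero                   = v , false
corner Q (v , i) (suc zero)             = lookup (rot Q v) i , twist Q v (lookup (rot Q v) i)
corner Q (v , i) (suc (suc zero))       = v , true
corner Q (v , i) (suc (suc (suc zero))) =
  lookup (rot Q v) (cnext i) , not (twist Q v (lookup (rot Q v) (cnext i)))

OnBoundary : ∀ {n} {G : Graph (Fin n)} (Q : Spinal G) → Face Q → (a b : Fin n × Bool) → Set
OnBoundary Q f a b = ∃[ j ] ((corner Q f j ≡ a × corner Q f (cnext j) ≡ b)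
                            ⊎ (corner Q f j ≡ b × corner Q f (cnext j) ≡ a))

FaceAdjacent : ∀ {n} {G : Graph (Fin n)} (Q : Spinal G) → Face Q → Face Q → Set
FaceAdjacent {n} Q f g = f ≢ g × (Σ (Fin n × Bool) λ a → Σ (Fin n × Bool) λ b →
                           OnBoundary Q f a b × OnBoundary Q g a b)

FaceColorable : ∀ {n} {G : Graph (Fin n)} → Spinal G → ℕ → Set
FaceColorable Q k = Σ (Face Q → Fin k) λ c → ∀ {f g} → FaceAdjacent Q f g → c f ≢ c g

IsFaceChromaticNumber : ∀ {n} {G : Graph (Fin n)} → Spinal G → ℕ → Set
IsFaceChromaticNumber Q k = FaceColorable Q k × (∀ j → FaceColorable Q j → k ≤ j)

{-# OPTIONS --safe #-}
-- Colour every face (v , i) of Q by the colour of its spine vertex v.  Each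
-- boundary edge of that face joins a copy of v to a corner over a neighbour
-- of v.  So if two faces share an edge, either their spine vertices are
-- adjacent in G, or they coincide and the shared corner over the neighbour
-- picks out the hole, hence the face.  Hence χ_F(Q) ≤ χ_V(G); and
-- χ_V(G[:]) = χ_V(G) because G[:] retracts onto the copy {v'} of G.
module Submission where

open import Defs hiding (sym)
open import Data.Nat using (ℕ; suc; _+_; _≤_; _<_)
open import Data.Nat.Properties using (+-suc; n<1+n)
open import Data.Nat.DivMod using (_%_; m%n<n; m<n⇒m%n≡m; [m+n]%n≡m%n; %-distribˡ-+)
open import Data.Fin using (Fin; toℕ; zero; suc)
open import Data.Fin.Properties using (toℕ-injective; toℕ<n; fromℕ<-injective)
open import Data.Bool using (Bool; true; false; not)
open import Data.Product using (_×_; _,_; proj₁)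
open import Data.Sum using (_⊎_; inj₁; inj₂; swap)
open import Data.List using (List; _∷_; lookup)
import Data.List.Relation.Unary.All as All
open import Data.List.Relation.Unary.AllPairs using (_∷_)
open import Data.List.Relation.Unary.Unique.Propositional using (Unique)
open import Data.List.Membership.Propositional.Properties using (∈-lookup)
open import Function using (_∘_)
open import Relation.Binary.PropositionalEquality
  using (_≡_; _≢_; refl; sym; trans; cong; module ≡-Reasoning)
open import Relation.Nullary using (contradiction)

lookup-injective : ∀ {a} {A : Set a} {xs : List A} → Unique xs →
                   ∀ i j → lookup xs i ≡ lookup xs j → i ≡ j
lookup-injective (_ ∷ _)      zero    zero    _  = refl
lookup-injective (x∉xs ∷ _)   zero    (suc j) eq = contradiction eq (All.lookup x∉xs (∈-lookup j))
lookup-injective (x∉xs ∷ _)   (suc i) zero    eq = contradiction (sym eq) (All.lookup x∉xs (∈-lookup i))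
lookup-injective (_ ∷ unique) (suc i) (suc j) eq = cong suc (lookup-injective unique i j eq)

-- Adding m is the inverse of suc modulo suc m.
[suc[a]%n+m]%n≡a : ∀ m {a} → a < suc m → (suc a % suc m + m) % suc m ≡ a
[suc[a]%n+m]%n≡a m {a} a<n = begin
  (suc a % suc m + m) % suc m         ≡⟨ cong (λ r → (suc a % suc m + r) % suc m) (sym (m<n⇒m%n≡m (n<1+n m))) ⟩
  (suc a % suc m + m % suc m) % suc m ≡⟨ sym (%-distribˡ-+ (suc a) m (suc m)) ⟩
  (suc a + m) % suc m                 ≡⟨ cong (_% suc m) (sym (+-suc a m)) ⟩
  (a + suc m) % suc m                 ≡⟨ [m+n]%n≡m%n a (suc m) ⟩
  a % suc m                           ≡⟨ m<n⇒m%n≡m a<n ⟩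
  a                                   ∎
  where open ≡-Reasoning

cnext-injective : ∀ {m} (i j : Fin m) → cnext i ≡ cnext j → i ≡ j
cnext-injective {suc m} i j eq = toℕ-injective (begin
  toℕ i                                  ≡⟨ sym ([suc[a]%n+m]%n≡a m (toℕ<n i)) ⟩
  (suc (toℕ i) % suc m + m) % suc m      ≡⟨ cong (λ r → (r + m) % suc m) suc-i≡suc-j ⟩
  (suc (toℕ j) % suc m + m) % suc m      ≡⟨ [suc[a]%n+m]%n≡a m (toℕ<n j) ⟩
  toℕ j                                  ∎)
  where
  open ≡-Reasoning
  suc-i≡suc-j : suc (toℕ i) % suc m ≡ suc (toℕ j) % suc m
  suc-i≡suc-j = fromℕ<-injective _ _ (m%n<n (suc (toℕ i)) (suc m)) (m%n<n (suc (toℕ j)) (suc m)) eq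

module _ {V : Set} (G : Graph V) where

  Colorable-interlace⁺ : ∀ {k} → Colorable G k → Colorable (interlace G) k
  Colorable-interlace⁺ (c , proper) = c ∘ proj₁ , proper

  Colorable-interlace⁻ : ∀ {k} → Colorable (interlace G) k → Colorable G k
  Colorable-interlace⁻ (d , proper) = (λ v → d (v , false)) , proper

  IsChromaticNumber-interlace : ∀ {k} → IsChromaticNumber G k → IsChromaticNumber (interlace G) k
  IsChromaticNumber-interlace (colorable , minimal) =
    Colorable-interlace⁺ colorable , λ j → minimal j ∘ Colorable-interlace⁻

module _ {n : ℕ} {G : Graph (Fin n)} (Q : Spinal G) where

  RimCorner : Face Q → Fin n × Bool → Set
  RimCorner (v , i) (u , b) =
      (u ≡ lookup (rot Q v) i × b ≡ twist Q v u)
    ⊎ (u ≡ lookup (rot Q v) (cnext i) × b ≡ not (twist Q v u))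

  Spoke : Face Q → Fin n × Bool → Fin n × Bool → Set
  Spoke f x y = proj₁ x ≡ proj₁ f × RimCorner f y

  corner-spoke : ∀ f j → Spoke f (corner Q f j) (corner Q f (cnext j))
                       ⊎ Spoke f (corner Q f (cnext j)) (corner Q f j)
  corner-spoke (v , i) zero                   = inj₁ (refl , inj₁ (refl , refl))
  corner-spoke (v , i) (suc zero)             = inj₂ (refl , inj₁ (refl , refl))
  corner-spoke (v , i) (suc (suc zero))       = inj₁ (refl , inj₂ (refl , refl))
  corner-spoke (v , i) (suc (suc (suc zero))) = inj₂ (refl , inj₂ (refl , refl))

  OnBoundary⇒Spoke : ∀ f a b → OnBoundary Q f a b → Spoke f a b ⊎ Spoke f b a
  OnBoundary⇒Spoke f _ _ (j , inj₁ (refl , refl)) = corner-spoke f j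
  OnBoundary⇒Spoke f _ _ (j , inj₂ (refl , refl)) = swap (corner-spoke f j)

  RimCorner⇒Adj : ∀ f y → RimCorner f y → Adj G (proj₁ f) (proj₁ y)
  RimCorner⇒Adj (v , i) _ (inj₁ (refl , _)) = rot-adj Q v _ (∈-lookup i)
  RimCorner⇒Adj (v , i) _ (inj₂ (refl , _)) = rot-adj Q v _ (∈-lookup (cnext i))

  b≢not[b] : ∀ b → b ≢ not b
  b≢not[b] false ()
  b≢not[b] true  ()

  -- The copy of u records whether u is the hole before or after the face.
  shared-rimCorner⇒≡ : ∀ v i j y → RimCorner (v , i) y → RimCorner (v , j) y → i ≡ j
  shared-rimCorner⇒≡ v i j _ (inj₁ (refl , _)) (inj₁ (u≡ , _)) =
    lookup-injective (rot-unique Q v) i j u≡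
  shared-rimCorner⇒≡ v i j _ (inj₂ (refl , _)) (inj₂ (u≡ , _)) =
    cnext-injective i j (lookup-injective (rot-unique Q v) _ _ u≡)
  shared-rimCorner⇒≡ v i j _ (inj₁ (refl , b≡)) (inj₂ (_ , b≡′)) =
    contradiction (trans (sym b≡) b≡′) (b≢not[b] _)
  shared-rimCorner⇒≡ v i j _ (inj₂ (refl , b≡)) (inj₁ (_ , b≡′)) =
    contradiction (trans (sym b≡′) b≡) (b≢not[b] _)

  module _ {k : ℕ} (c : Fin n → Fin k) (proper : ∀ {u v} → Adj G u v → c u ≢ c v) where

    same-colour-spoke⇒≡ : ∀ f g x y → Spoke f x y → Spoke g x y ⊎ Spoke g y x →
                          c (proj₁ f) ≡ c (proj₁ g) → f ≡ g
    same-colour-spoke⇒≡ (v , i) (w , j) x y (refl , rim) (inj₁ (refl , rim′)) _ =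
      cong (proj₁ x ,_) (shared-rimCorner⇒≡ (proj₁ x) i j y rim rim′)
    same-colour-spoke⇒≡ f (w , j) x y (refl , rim) (inj₂ (y≡w , _)) cf≡cg =
      contradiction (trans cf≡cg (cong c (sym y≡w))) (proper (RimCorner⇒Adj f y rim))

    same-colour-edge⇒≡ : ∀ f g a b → OnBoundary Q f a b → OnBoundary Q g a b →
                         c (proj₁ f) ≡ c (proj₁ g) → f ≡ g
    same-colour-edge⇒≡ f g a b ∂f ∂g with OnBoundary⇒Spoke f a b ∂f | OnBoundary⇒Spoke g a b ∂g
    ... | inj₁ spoke | spoke′ = same-colour-spoke⇒≡ f g a b spoke spoke′
    ... | inj₂ spoke | spoke′ = same-colour-spoke⇒≡ f g b a spoke (swap spoke′)

    spine-colour-proper : ∀ {f g} → FaceAdjacent Q f g → c (proj₁ f) ≢ c (proj₁ g)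
    spine-colour-proper {f} {g} (f≢g , a , b , ∂f , ∂g) = f≢g ∘ same-colour-edge⇒≡ f g a b ∂f ∂g

  Colorable⇒FaceColorable : ∀ {k} → Colorable G k → FaceColorable Q k
  Colorable⇒FaceColorable (c , proper) = c ∘ proj₁ , spine-colour-proper c proper

lemma3p4 : ∀ {n : ℕ} (G : Graph (Fin n)) → Connected G → HasEdge G →
    (Q : Spinal G) → (k : ℕ) → IsChromaticNumber G k →
    IsChromaticNumber (interlace G) k × (∀ m → IsFaceChromaticNumber Q m → m ≤ k)
lemma3p4 G _ _ Q k χ@(colorable , _) =
  IsChromaticNumber-interlace G χ , λ m (_ , minimal) → minimal k (Colorable⇒FaceColorable Q colorable)
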